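{- Let $E$ be a finite set, $a,b\in E$ distinct, $(\sigma_\circ,\sigma_\bullet)$ any pair in $S_E$, and $(\sigma_\circ^\oplus,\sigma_\bullet^\oplus)$ its reroute relative to $(a,b)$. If $x\in E$, $x\neq a$ and $\sigma_\circ\sigma_\bullet(x)\notin\{a,\sigma_\circ(a),b\}$, then $x\in E^\oplus$ and $\sigma_\circ^\oplus\sigma_\bullet^\oplus(x)=\sigma_\circ\sigma_\bullet(x)$. In particular, every $\sigma_\circ\sigma_\bullet$-orbit $O$ with $O\cap\{a,\sigma_\circ(a),b\}=\emptyset$ is also a $\sigma_\circ^\oplus\sigma_\bullet^\oplus$-orbit.
   Context: Permutations compose functionally. Reroute relative to $(a,b)$: $E^\oplus=(E\setminus\{a\})\sqcup\{a_\circ,a_\bullet\}$; $\sigma_\circ^\oplus$ is obtained from the disjoint cycle decomposition of $\sigma_\circ$ (fixed points as 1-cycles) by replacing $a$ by $a_\circ$ and inserting $a_\bullet$ immediately before $b$ in the cycle containing $b$; $\sigma_\bullet^\oplus$ is obtained from that of $\sigma_\bullet$ by replacing $a$ by $a_\bullet$ and adjoining the fixed point $a_\circ$. -}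

module Defs where

open import Data.Nat using (ℕ; zero; suc)
open import Data.Fin using (Fin; _≟_)
open import Data.Fin.Permutation using (Permutation′; _⟨$⟩ʳ_; _⟨$⟩ˡ_)
open import Data.Product using (∃; _×_)
open import Relation.Nullary using (yes; no)
open import Relation.Binary.PropositionalEquality using (_≡_; _≢_)

iter : {A : Set} → (A → A) → ℕ → A → A
iter f zero    x = x
iter f (suc k) x = f (iter f k x)

InOrbit : {A : Set} → (A → A) → A → A → Set
InOrbit f x y = ∃ λ k → iter f k x ≡ y

-- E = Fin n.  E⊕ = (E ∖ {a}) ⊔ {a∘ , a•}.
-- old e p : the element e ∈ E ∖ {a} (proof argument irrelevant).
data Plus {n : ℕ} (a : Fin n) : Set where
  old : (e : Fin n) → .(e ≢ a) → Plus a
  a∘  : Plus a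
  a•  : Plus a

ι∘ : ∀ {n} (a : Fin n) → Fin n → Plus a
ι∘ a y with y ≟ a
... | yes _ = a∘
... | no ne = old y ne

ι• : ∀ {n} (a : Fin n) → Fin n → Plus a
ι• a y with y ≟ a
... | yes _ = a•
... | no ne = old y ne

-- σ∘⊕: in the cycle decomposition of σ∘, replace a by a∘ and insert a•
-- immediately before b.
private
  step∘ : ∀ {n} (a b : Fin n) (σ∘ : Permutation′ n) → Fin n → Plus a
  step∘ a b σ∘ y with y ≟ (σ∘ ⟨$⟩ˡ b)
  ... | yes _ = a•
  ... | no _  = ι∘ a (σ∘ ⟨$⟩ʳ y)

reroute∘ : ∀ {n} (a b : Fin n) (σ∘ : Permutation′ n) → Plus a → Plus a
reroute∘ a b σ∘ (old y _) = step∘ a b σ∘ y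
reroute∘ a b σ∘ a∘        = step∘ a b σ∘ a
reroute∘ a b σ∘ a•        = ι∘ a b

reroute• : ∀ {n} (a : Fin n) (σ• : Permutation′ n) → Plus a → Plus a
reroute• a σ• (old y _) = ι• a (σ• ⟨$⟩ʳ y)
reroute• a σ• a∘        = a∘
reroute• a σ• a•        = ι• a (σ• ⟨$⟩ʳ a)

-- Away from a, σ∘ a and b the reroute only renames points: σ•⊕ acts on an old point x as σ• does,
-- and σ∘⊕ deviates from σ∘ only at a∘, a•, and the σ∘-predecessor of b.  Hence σ∘⊕σ•⊕ agrees with
-- σ∘σ• at every x whose image avoids a, σ∘ a and b; iterating this along an orbit avoiding those
-- three points shows the orbit survives unchanged.
module Submission where

open import Defs
open import Data.Nat using (ℕ; zero; suc)
open import Data.Fin using (Fin; _≟_)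
open import Data.Fin.Permutation using (Permutation′; _⟨$⟩ʳ_; _⟨$⟩ˡ_; inverseʳ)
open import Data.Product using (∃; _×_; _,_)
open import Data.Empty using (⊥-elim)
open import Relation.Nullary using (yes; no)
open import Function.Bundles using (_⇔_; mk⇔)
open import Relation.Binary.PropositionalEquality
  using (_≡_; _≢_; refl; sym; trans; cong; module ≡-Reasoning)

module _ {A B : Set} (f : A → A) (g : B → B) (ι : A → B) (x : A)
         (intertwine : ∀ k → g (ι (iter f k x)) ≡ ι (iter f (suc k) x)) where

  iter-intertwine : ∀ k → iter g k (ι x) ≡ ι (iter f k x)
  iter-intertwine zero    = refl
  iter-intertwine (suc k) = trans (cong g (iter-intertwine k)) (intertwine k)

  InOrbit-image : ∀ w → InOrbit g (ι x) w ⇔ (∃ λ y → InOrbit f x y × ι y ≡ w)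
  InOrbit-image w = mk⇔ forward backward
    where
    forward : InOrbit g (ι x) w → ∃ λ y → InOrbit f x y × ι y ≡ w
    forward (k , gᵏx≡w) = iter f k x , (k , refl) , trans (sym (iter-intertwine k)) gᵏx≡w

    backward : (∃ λ y → InOrbit f x y × ι y ≡ w) → InOrbit g (ι x) w
    backward (y , (k , fᵏx≡y) , ιy≡w) =
      k , trans (iter-intertwine k) (trans (cong ι fᵏx≡y) ιy≡w)

module _ {n : ℕ} (a : Fin n) where

  ι∘-old : ∀ y (y≢a : y ≢ a) → ι∘ a y ≡ old y y≢a
  ι∘-old y y≢a with y ≟ a
  ... | yes y≡a = ⊥-elim (y≢a y≡a)
  ... | no _    = refl

  ι•-old : ∀ y (y≢a : y ≢ a) → ι• a y ≡ old y y≢a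
  ι•-old y y≢a with y ≟ a
  ... | yes y≡a = ⊥-elim (y≢a y≡a)
  ... | no _    = refl

  reroute∘-old : ∀ b (σ∘ : Permutation′ n) y (y≢a : y ≢ a) → y ≢ σ∘ ⟨$⟩ˡ b →
                 reroute∘ a b σ∘ (old y y≢a) ≡ ι∘ a (σ∘ ⟨$⟩ʳ y)
  reroute∘-old b σ∘ y _ y≢σ∘⁻¹b with y ≟ (σ∘ ⟨$⟩ˡ b)
  ... | yes y≡σ∘⁻¹b = ⊥-elim (y≢σ∘⁻¹b y≡σ∘⁻¹b)
  ... | no _        = refl

  reroute-old : ∀ b (σ∘ σ• : Permutation′ n) x (x≢a : x ≢ a) →
                (h : σ∘ ⟨$⟩ʳ (σ• ⟨$⟩ʳ x) ≢ a) →
                σ∘ ⟨$⟩ʳ (σ• ⟨$⟩ʳ x) ≢ σ∘ ⟨$⟩ʳ a → σ∘ ⟨$⟩ʳ (σ• ⟨$⟩ʳ x) ≢ b →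
                reroute∘ a b σ∘ (reroute• a σ• (old x x≢a)) ≡ old (σ∘ ⟨$⟩ʳ (σ• ⟨$⟩ʳ x)) h
  reroute-old b σ∘ σ• x _ h fx≢σ∘a fx≢b = begin
    reroute∘ a b σ∘ (ι• a y)        ≡⟨ cong (reroute∘ a b σ∘) (ι•-old y y≢a) ⟩
    reroute∘ a b σ∘ (old y y≢a)     ≡⟨ reroute∘-old b σ∘ y y≢a y≢σ∘⁻¹b ⟩
    ι∘ a (σ∘ ⟨$⟩ʳ y)                ≡⟨ ι∘-old (σ∘ ⟨$⟩ʳ y) h ⟩
    old (σ∘ ⟨$⟩ʳ y) h               ∎
    where
    open ≡-Reasoning
    y = σ• ⟨$⟩ʳ x

    y≢a : y ≢ a
    y≢a y≡a = fx≢σ∘a (cong (σ∘ ⟨$⟩ʳ_) y≡a)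

    y≢σ∘⁻¹b : y ≢ σ∘ ⟨$⟩ˡ b
    y≢σ∘⁻¹b y≡σ∘⁻¹b = fx≢b (trans (cong (σ∘ ⟨$⟩ʳ_) y≡σ∘⁻¹b) (inverseʳ σ∘))

mainTheorem17 : ∀ {n : ℕ} (a b : Fin n) → a ≢ b → (σ∘ σ• : Permutation′ n) →
    ((x : Fin n) (x≢a : x ≢ a) (h : σ∘ ⟨$⟩ʳ (σ• ⟨$⟩ʳ x) ≢ a) →
       σ∘ ⟨$⟩ʳ (σ• ⟨$⟩ʳ x) ≢ σ∘ ⟨$⟩ʳ a → σ∘ ⟨$⟩ʳ (σ• ⟨$⟩ʳ x) ≢ b →
       reroute∘ a b σ∘ (reroute• a σ• (old x x≢a)) ≡ old (σ∘ ⟨$⟩ʳ (σ• ⟨$⟩ʳ x)) h)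
    ×
    ((x : Fin n) →
       (∀ y → InOrbit (λ z → σ∘ ⟨$⟩ʳ (σ• ⟨$⟩ʳ z)) x y → y ≢ a × y ≢ σ∘ ⟨$⟩ʳ a × y ≢ b) →
       ∀ (w : Plus a) →
         InOrbit (λ z → reroute∘ a b σ∘ (reroute• a σ• z)) (ι∘ a x) w
         ⇔ (∃ λ y → InOrbit (λ z → σ∘ ⟨$⟩ʳ (σ• ⟨$⟩ʳ z)) x y × ι∘ a y ≡ w))
mainTheorem17 {n} a b _ σ∘ σ• = reroute-old a b σ∘ σ• , orbit-preserved
  where
  σ : Fin n → Fin n
  σ z = σ∘ ⟨$⟩ʳ (σ• ⟨$⟩ʳ z)

  σ⊕ : Plus a → Plus a
  σ⊕ z = reroute∘ a b σ∘ (reroute• a σ• z)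

  orbit-preserved : ∀ x → (∀ y → InOrbit σ x y → y ≢ a × y ≢ σ∘ ⟨$⟩ʳ a × y ≢ b) →
                    ∀ w → InOrbit σ⊕ (ι∘ a x) w ⇔ (∃ λ y → InOrbit σ x y × ι∘ a y ≡ w)
  orbit-preserved x avoids = InOrbit-image σ σ⊕ (ι∘ a) x intertwine
    where
    intertwine : ∀ k → σ⊕ (ι∘ a (iter σ k x)) ≡ ι∘ a (iter σ (suc k) x)
    intertwine k with avoids (iter σ k x) (k , refl) | avoids (iter σ (suc k) x) (suc k , refl)
    ... | y≢a , _ , _ | σy≢a , σy≢σ∘a , σy≢b = begin
      σ⊕ (ι∘ a y)          ≡⟨ cong σ⊕ (ι∘-old a y y≢a) ⟩
      σ⊕ (old y y≢a)       ≡⟨ reroute-old a b σ∘ σ• y y≢a σy≢a σy≢σ∘a σy≢b ⟩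
      old (σ y) σy≢a       ≡⟨ sym (ι∘-old a (σ y) σy≢a) ⟩
      ι∘ a (σ y)           ∎
      where
      open ≡-Reasoning
      y = iter σ k x
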